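{- A $\mathrm{CHA}$-pre-proof $\pi$ (whose underlying cyclic tree is in cycle normal form) is a $\mathrm{CHA}$-proof if and only if there exists an induction order for it.
   Context: Language: first-order arithmetic (terms from variables, $0,S,+,\cdot$). $\mathrm{CHA}$ rules: standard intuitionistic sequent calculus rules for first-order logic with equality, weakening, cut, the arithmetic axioms, and $\textsc{Case}_x$ (from $\Gamma[0/x]\Rightarrow\delta[0/x]$ and $\Gamma[Sx/x]\Rightarrow\delta[Sx/x]$ infer $\Gamma\Rightarrow\delta$). Trees are non-empty prefix-closed $T\subseteq\omega^*$ ($s<t$: strict prefix). A cyclic tree is $(T,\beta)$, $T$ finite, $\beta$ a partial map from leaves to inner nodes (buds and companions), in cycle normal form: $\beta(t)<t$ for each bud. A pre-proof $\pi=((T,\beta),\rho)$ assigns rule instances to non-bud nodes, children labelled by premises, buds labelled by their companion's sequent; $\lambda(t)$ denotes the sequent at $t$. An infinite branch starts at the root, each step to a child or from a bud to its companion. A $\mathrm{CHA}$-proof is a pre-proof such that along every infinite branch some variable $x$ is, from some point on, free in every sequent and the branch passes instances of $\textsc{Case}_x$ infinitely often. Local cycle of bud $t$: $\gamma(t):=\{u\mid\beta(t)\le u\le t\}$; $C[\eta]:=\bigcup_{s\in\eta}\gamma(s)$. A finite path is a non-empty node sequence with steps as for branches. $\eta\subseteq\mathrm{dom}(\beta)$ is strongly connected if some finite path starting and ending at the same node visits exactly the nodes of $C[\eta]$. An induction order is a preorder $\preceq$ on $\mathrm{dom}(\beta)$ together with a map $s\mapsto x_s$ from $\mathrm{dom}(\beta)$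 to variables with $x_s\in\mathrm{FV}(\lambda(s))$, such that: if $s\preceq t$ then $x_t\in\mathrm{FV}(\lambda(u))$ for every $u\in\gamma(s)$; for each bud $s$ an instance of $\textsc{Case}_{x_s}$ is applied along $\gamma(s)$; every strongly connected $\eta\subseteq\mathrm{dom}(\beta)$ has a $\preceq$-maximum in $\eta$. -}

module Defs where

open import Level using (Level) renaming (suc to lsuc; zero to lzero)
open import Data.Nat using (ℕ; zero; suc; _<_; _≤_; _≡ᵇ_)
open import Data.Bool using (Bool; true; false; if_then_else_)
open import Data.List using (List; []; _∷_; _++_; length; [_]; _∷ʳ_; map; lookup; head; last)
open import Data.List.Membership.Propositional using (_∈_; _∉_)
open import Data.List.Relation.Unary.All using (All)
open import Data.List.Relation.Unary.Any using (Any)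
open import Data.List.Relation.Binary.Subset.Propositional using (_⊆_)
open import Data.Fin using (Fin; toℕ)
open import Data.Maybe using (Maybe; just; nothing)
open import Data.Product using (Σ; ∃; _×_; _,_)
open import Data.Sum using (_⊎_)
open import Data.Unit using (⊤)
open import Data.Empty using (⊥)
open import Relation.Nullary using (¬_)
open import Relation.Binary.PropositionalEquality using (_≡_; _≢_)
open import Function.Bundles using (_⇔_)

Var : Set
Var = ℕ

data Term : Set where
  var  : Var → Term
  `0   : Term
  `S   : Term → Term
  _`+_ : Term → Term → Term
  _`·_ : Term → Term → Term

data Formula : Set where
  `⊥   : Formula
  _≐_  : Term → Term → Formula
  _`∧_ : Formula → Formula → Formula
  _`∨_ : Formula → Formula → Formula
  _`→_ : Formula → Formula → Formula
  `∀   : Var → Formula → Formula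
  `∃   : Var → Formula → Formula

data _∈FVᵗ_ (x : Var) : Term → Set where
  var : x ∈FVᵗ var x
  S   : ∀ {t} → x ∈FVᵗ t → x ∈FVᵗ `S t
  +l  : ∀ {s t} → x ∈FVᵗ s → x ∈FVᵗ (s `+ t)
  +r  : ∀ {s t} → x ∈FVᵗ t → x ∈FVᵗ (s `+ t)
  ·l  : ∀ {s t} → x ∈FVᵗ s → x ∈FVᵗ (s `· t)
  ·r  : ∀ {s t} → x ∈FVᵗ t → x ∈FVᵗ (s `· t)

data _∈FV_ (x : Var) : Formula → Set where
  ≐l : ∀ {s t} → x ∈FVᵗ s → x ∈FV (s ≐ t)
  ≐r : ∀ {s t} → x ∈FVᵗ t → x ∈FV (s ≐ t)
  ∧l : ∀ {A B} → x ∈FV A → x ∈FV (A `∧ B)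
  ∧r : ∀ {A B} → x ∈FV B → x ∈FV (A `∧ B)
  ∨l : ∀ {A B} → x ∈FV A → x ∈FV (A `∨ B)
  ∨r : ∀ {A B} → x ∈FV B → x ∈FV (A `∨ B)
  →l : ∀ {A B} → x ∈FV A → x ∈FV (A `→ B)
  →r : ∀ {A B} → x ∈FV B → x ∈FV (A `→ B)
  ∀b : ∀ {y A} → x ≢ y → x ∈FV A → x ∈FV `∀ y A
  ∃b : ∀ {y A} → x ≢ y → x ∈FV A → x ∈FV `∃ y A

_∈FVᶜ_ : Var → List Formula → Set
x ∈FVᶜ Γ = Any (x ∈FV_) Γ

tsub : Term → Var → Term → Term
tsub (var y)  x s = if y ≡ᵇ x then s else var y
tsub `0       x s = `0
tsub (`S t)   x s = `S (tsub t x s)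
tsub (t `+ u) x s = tsub t x s `+ tsub u x s
tsub (t `· u) x s = tsub t x s `· tsub u x s

fsub : Formula → Var → Term → Formula
fsub `⊥       x s = `⊥
fsub (t ≐ u)  x s = tsub t x s ≐ tsub u x s
fsub (A `∧ B) x s = fsub A x s `∧ fsub B x s
fsub (A `∨ B) x s = fsub A x s `∨ fsub B x s
fsub (A `→ B) x s = fsub A x s `→ fsub B x s
fsub (`∀ y A) x s = if y ≡ᵇ x then `∀ y A else `∀ y (fsub A x s)
fsub (`∃ y A) x s = if y ≡ᵇ x then `∃ y A else `∃ y (fsub A x s)

FreeFor : Term → Var → Formula → Set
FreeFor s x `⊥       = ⊤
FreeFor s x (_ ≐ _)  = ⊤
FreeFor s x (A `∧ B) = FreeFor s x A × FreeFor s x B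
FreeFor s x (A `∨ B) = FreeFor s x A × FreeFor s x B
FreeFor s x (A `→ B) = FreeFor s x A × FreeFor s x B
FreeFor s x (`∀ y A) = x ∈FV `∀ y A → (¬ (y ∈FVᵗ s) × FreeFor s x A)
FreeFor s x (`∃ y A) = x ∈FV `∃ y A → (¬ (y ∈FVᵗ s) × FreeFor s x A)

infix 3 _⊢_

record Sequent : Set where
  constructor _⊢_
  field
    ant : List Formula
    succ : Formula

_∈FVˢ_ : Var → Sequent → Set
x ∈FVˢ (Γ ⊢ δ) = x ∈FVᶜ Γ ⊎ x ∈FV δ

csub : List Formula → Var → Term → List Formula
csub Γ x s = map (λ A → fsub A x s) Γ

data Rule : Set where
  ax    : (A : Formula) → Rule
  ⊥L    : (δ : Formula) → Rule
  ∧R    : (Γ : List Formula) (A B : Formula) → Rule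
  ∧L    : (Γ : List Formula) (A B δ : Formula) → Rule
  ∨R₁   : (Γ : List Formula) (A B : Formula) → Rule
  ∨R₂   : (Γ : List Formula) (A B : Formula) → Rule
  ∨L    : (Γ : List Formula) (A B δ : Formula) → Rule
  →R    : (Γ : List Formula) (A B : Formula) → Rule
  →L    : (Γ : List Formula) (A B δ : Formula) → Rule
  ∀R    : (Γ : List Formula) (x y : Var) (A : Formula) →
          ¬ (y ∈FVᶜ Γ) → ¬ (y ∈FV `∀ x A) → FreeFor (var y) x A → Rule
  ∀L    : (Γ : List Formula) (x : Var) (t : Term) (A δ : Formula) →
          FreeFor t x A → Rule
  ∃R    : (Γ : List Formula) (x : Var) (t : Term) (A : Formula) →
          FreeFor t x A → Rule
  ∃L    : (Γ : List Formula) (x y : Var) (A δ : Formula) →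
          ¬ (y ∈FVᶜ Γ) → ¬ (y ∈FV `∃ x A) → ¬ (y ∈FV δ) → FreeFor (var y) x A → Rule
  =refl  : (t : Term) → Rule
  =subst : (s t : Term) (x : Var) (A : Formula) → FreeFor s x A → FreeFor t x A → Rule
  wk    : (Γ Γ' : List Formula) (δ : Formula) → Γ ⊆ Γ' → Rule
  cut   : (Γ : List Formula) (A δ : Formula) → Rule
  Q1    : (s t : Term) → Rule
  Q2    : (s : Term) → Rule
  Q3    : (s : Term) → Rule
  Q4    : (s t : Term) → Rule
  Q5    : (s : Term) → Rule
  Q6    : (s t : Term) → Rule
  Case  : (Γ : List Formula) (δ : Formula) (x : Var) → Rule

premises : Rule → List Sequent
premises (ax A)                 = []
premises (⊥L δ)                 = []
premises (∧R Γ A B)             = (Γ ⊢ A) ∷ (Γ ⊢ B) ∷ []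
premises (∧L Γ A B δ)           = (A ∷ B ∷ Γ ⊢ δ) ∷ []
premises (∨R₁ Γ A B)            = (Γ ⊢ A) ∷ []
premises (∨R₂ Γ A B)            = (Γ ⊢ B) ∷ []
premises (∨L Γ A B δ)           = (A ∷ Γ ⊢ δ) ∷ (B ∷ Γ ⊢ δ) ∷ []
premises (→R Γ A B)             = (A ∷ Γ ⊢ B) ∷ []
premises (→L Γ A B δ)           = (Γ ⊢ A) ∷ (B ∷ Γ ⊢ δ) ∷ []
premises (∀R Γ x y A _ _ _)     = (Γ ⊢ fsub A x (var y)) ∷ []
premises (∀L Γ x t A δ _)       = (fsub A x t ∷ Γ ⊢ δ) ∷ []
premises (∃R Γ x t A _)         = (Γ ⊢ fsub A x t) ∷ []
premises (∃L Γ x y A δ _ _ _ _) = (fsub A x (var y) ∷ Γ ⊢ δ) ∷ []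
premises (=refl t)              = []
premises (=subst s t x A _ _)   = []
premises (wk Γ Γ' δ _)          = (Γ ⊢ δ) ∷ []
premises (cut Γ A δ)            = (Γ ⊢ A) ∷ (A ∷ Γ ⊢ δ) ∷ []
premises (Q1 s t)               = []
premises (Q2 s)                 = []
premises (Q3 s)                 = []
premises (Q4 s t)               = []
premises (Q5 s)                 = []
premises (Q6 s t)               = []
premises (Case Γ δ x)           = (csub Γ x `0 ⊢ fsub δ x `0)
                                ∷ (csub Γ x (`S (var x)) ⊢ fsub δ x (`S (var x))) ∷ []

conclusion : Rule → Sequent
conclusion (ax A)                 = A ∷ [] ⊢ A
conclusion (⊥L δ)                 = `⊥ ∷ [] ⊢ δ
conclusion (∧R Γ A B)             = Γ ⊢ (A `∧ B)
conclusion (∧L Γ A B δ)           = (A `∧ B) ∷ Γ ⊢ δ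
conclusion (∨R₁ Γ A B)            = Γ ⊢ (A `∨ B)
conclusion (∨R₂ Γ A B)            = Γ ⊢ (A `∨ B)
conclusion (∨L Γ A B δ)           = (A `∨ B) ∷ Γ ⊢ δ
conclusion (→R Γ A B)             = Γ ⊢ (A `→ B)
conclusion (→L Γ A B δ)           = (A `→ B) ∷ Γ ⊢ δ
conclusion (∀R Γ x y A _ _ _)     = Γ ⊢ `∀ x A
conclusion (∀L Γ x t A δ _)       = `∀ x A ∷ Γ ⊢ δ
conclusion (∃R Γ x t A _)         = Γ ⊢ `∃ x A
conclusion (∃L Γ x y A δ _ _ _ _) = `∃ x A ∷ Γ ⊢ δ
conclusion (=refl t)              = [] ⊢ (t ≐ t)
conclusion (=subst s t x A _ _)   = (s ≐ t) ∷ fsub A x s ∷ [] ⊢ fsub A x t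
conclusion (wk Γ Γ' δ _)          = Γ' ⊢ δ
conclusion (cut Γ A δ)            = Γ ⊢ δ
conclusion (Q1 s t)               = (`S s ≐ `S t) ∷ [] ⊢ (s ≐ t)
conclusion (Q2 s)                 = (`S s ≐ `0) ∷ [] ⊢ `⊥
conclusion (Q3 s)                 = [] ⊢ ((s `+ `0) ≐ s)
conclusion (Q4 s t)               = [] ⊢ ((s `+ `S t) ≐ `S (s `+ t))
conclusion (Q5 s)                 = [] ⊢ ((s `· `0) ≐ `0)
conclusion (Q6 s t)               = [] ⊢ ((s `· `S t) ≐ ((s `· t) `+ s))
conclusion (Case Γ δ x)           = Γ ⊢ δ

IsCase : Var → Rule → Set
IsCase x (Case Γ δ y) = x ≡ y
IsCase x _            = ⊥

Node : Set
Node = List ℕ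

_⊑_ : Node → Node → Set
u ⊑ v = ∃ λ r → u ++ r ≡ v

_⊏_ : Node → Node → Set
u ⊏ v = ∃ λ r → r ≢ [] × u ++ r ≡ v

IsLeaf : List Node → Node → Set
IsLeaf T t = ∀ i → (t ∷ʳ i) ∉ T

record CyclicTree : Set where
  field
    T             : List Node
    β             : Node → Maybe Node
    root∈T        : [] ∈ T
    prefix-closed : ∀ {t u} → t ∈ T → u ⊑ t → u ∈ T
    bud-leaf      : ∀ {t c} → β t ≡ just c → t ∈ T × IsLeaf T t
    comp-inner    : ∀ {t c} → β t ≡ just c → c ∈ T × ¬ IsLeaf T c
    normal-form   : ∀ {t c} → β t ≡ just c → c ⊏ t

label : CyclicTree → (Node → Rule) → Node → Sequent
label τ ρ t with CyclicTree.β τ t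
... | just c  = conclusion (ρ c)
... | nothing = conclusion (ρ t)

record PreProof : Set where
  field
    tree     : CyclicTree
    ρ        : Node → Rule
    children : ∀ {t} → t ∈ CyclicTree.T tree → CyclicTree.β tree t ≡ nothing →
               ∀ i → ((t ∷ʳ i) ∈ CyclicTree.T tree ⇔ i < length (premises (ρ t)))
    labels   : ∀ {t} → t ∈ CyclicTree.T tree → CyclicTree.β tree t ≡ nothing →
               (i : Fin (length (premises (ρ t)))) →
               label tree ρ (t ∷ʳ toℕ i) ≡ lookup (premises (ρ t)) i

module _ (π : PreProof) where
  open PreProof π
  open CyclicTree tree

  λˢ : Node → Sequent
  λˢ = label tree ρ

  InDom : Node → Set
  InDom s = ∃ λ c → β s ≡ just c

  Step : Node → Node → Set
  Step t u = (β t ≡ nothing × (∃ λ i → u ≡ t ∷ʳ i) × u ∈ T) ⊎ β t ≡ just u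

  InfiniteBranch : (ℕ → Node) → Set
  InfiniteBranch b = b 0 ≡ [] × (∀ n → Step (b n) (b (suc n)))

  IsProof : Set
  IsProof = ∀ b → InfiniteBranch b → ∃ λ x →
              (∃ λ m → ∀ n → m ≤ n → x ∈FVˢ λˢ (b n))
            × (∀ m → ∃ λ n → m ≤ n × β (b n) ≡ nothing × IsCase x (ρ (b n)))

  InCycle : Node → Node → Set
  InCycle s u = ∃ λ c → β s ≡ just c × c ⊑ u × u ⊑ s

  InC : List Node → Node → Set
  InC η u = ∃ λ s → s ∈ η × InCycle s u

  data Path : List Node → Set where
    one  : ∀ t → Path (t ∷ [])
    step : ∀ {t u p} → Step t u → Path (u ∷ p) → Path (t ∷ u ∷ p)

  StronglyConnected : List Node → Set
  StronglyConnected η =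
    All InDom η ×
    (∃ λ p → Path p × head p ≡ last p × (∀ u → (u ∈ p ⇔ InC η u)))

  record InductionOrder : Set₁ where
    field
      _⪯_        : Node → Node → Set
      xv         : Node → Var
      ⪯-refl     : ∀ {s} → InDom s → s ⪯ s
      ⪯-trans    : ∀ {s t u} → InDom s → InDom t → InDom u → s ⪯ t → t ⪯ u → s ⪯ u
      xv-free    : ∀ {s} → InDom s → xv s ∈FVˢ λˢ s
      order-free : ∀ {s t} → InDom s → InDom t → s ⪯ t →
                   ∀ {u} → InCycle s u → xv t ∈FVˢ λˢ u
      case-along : ∀ {s} → InDom s →
                   ∃ λ u → InCycle s u × u ≢ s × IsCase (xv s) (ρ u)
      sc-max     : ∀ η → StronglyConnected η →
                   ∃ λ s → s ∈ η × (∀ {t} → t ∈ η → t ⪯ s)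

-- (⇐) Along an infinite branch some node recurs, and the nodes that recur are exactly C[η] for the
-- set η of recurring buds: the branch only climbs back above a node through a bud whose companion
-- lies above it. A tail of the branch from a recurring node back to itself is a closed path through
-- C[η], so η is strongly connected, and for its ⪯-maximum s the variable x_s is eventually always
-- free while Case_{x_s} in γ(s) is passed on every round of γ(s).
-- (⇒) Build the order by removing buds from a set R one at a time. The strongly connected subsets
-- of R containing a bud s₀ unite to one, K; the branch circling a closed path through C[K] forever
-- gives a variable x free on all of C[K] and a Case_x inside some γ(t), t ∈ K. Put t above every bud
-- sharing a strongly connected subset of R with it, set x_t = x, and recurse on R ∖ {t}.

module Submission where

open import Defs
open import Axiom.ExcludedMiddle using (ExcludedMiddle)
open import Function.Bundles using (_⇔_; mk⇔; Equivalence)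
open import Level using (0ℓ)
open import Data.Nat using (ℕ; zero; suc; _+_; _≤_; _<_; _≤′_; ≤′-refl; ≤′-step; s≤s; _≟_)
open import Data.Nat.Properties using (m≤n⇒∃[o]m+o≡n; ≤-refl; ≤-trans; ≤-pred; ≤-antisym; m≤m+n; m≤n+m; n≤1+n; ≤′⇒≤; ≤⇒≤′; m≤n⇒m<n∨m≡n)
open import Data.List using (List; []; _∷_; _++_; [_]; _∷ʳ_; filter; length; last; initLast; _∷ʳ′_)
open import Data.List.Properties using (≡-dec; filter-notAll; ++-assoc; ++-identityʳ; ++-identityʳ-unique; ++-conicalˡ; ++-conicalʳ; ∷-injective; ∷ʳ-injective)
open import Data.List.Membership.Propositional using (_∈_)
open import Data.List.Membership.Propositional.Properties using (∈-++⁺ˡ; ∈-++⁺ʳ; ∈-++⁻; ∈-filter⁺; ∈-filter⁻)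
open import Data.List.Relation.Binary.Subset.Propositional using (_⊆_)
open import Data.List.Relation.Binary.Subset.Propositional.Properties using (xs⊆xs++ys; xs⊆ys++xs; ∷⁺ʳ)
open import Data.Maybe.Properties using (just-injective)
open import Function using (case_of_)
open import Data.List.Relation.Unary.Any as Any using (here; there)
open import Data.List.Relation.Unary.All as All using (All; []; _∷_)
import Data.List.Relation.Unary.All.Properties as Allₚ
open import Data.Maybe using (just; nothing)
open import Data.Product using (∃; _×_; _,_; proj₁; proj₂)
open import Data.Sum using (_⊎_; inj₁; inj₂; [_,_]′)
open import Data.Empty using (⊥)
open import Relation.Nullary using (¬_; ¬?; Dec; yes; no; contradiction; _×-dec_)
open import Relation.Binary.Definitions using (DecidableEquality)
open import Relation.Binary.PropositionalEquality using (_≡_; _≢_; refl; sym; trans; cong; subst)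

rotate-⊆ : ∀ {A : Set} {a s : A} {ys₁ ys₂} → a ∈ s ∷ ys₂ → a ∷ ys₁ ++ ys₂ ⊆ s ∷ ys₂ ++ ys₁
rotate-⊆ {s = s} {ys₁} {ys₂} a∈ (here refl) = xs⊆xs++ys (s ∷ ys₂) ys₁ a∈
rotate-⊆ {s = s} {ys₁} {ys₂} a∈ (there u∈) with ∈-++⁻ ys₁ u∈
... | inj₁ u∈₁ = there (∈-++⁺ʳ ys₂ u∈₁)
... | inj₂ u∈₂ = there (∈-++⁺ˡ u∈₂)

++-⊆ : ∀ {A : Set} {xs ys zs : List A} → xs ⊆ zs → ys ⊆ zs → xs ++ ys ⊆ zs
++-⊆ {xs = xs} xs⊆zs ys⊆zs u∈ = [ xs⊆zs , ys⊆zs ]′ (∈-++⁻ xs u∈)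

_≟ᴺ_ : DecidableEquality Node
_≟ᴺ_ = ≡-dec _≟_

_∖_ : List Node → Node → List Node
R ∖ t = filter (λ s → ¬? (s ≟ᴺ t)) R

∈-∖⁺ : ∀ {R s t} → s ∈ R → s ≢ t → s ∈ R ∖ t
∈-∖⁺ {t = t} = ∈-filter⁺ (λ s → ¬? (s ≟ᴺ t))

∈-∖⁻ : ∀ R {s t} → s ∈ R ∖ t → s ∈ R × s ≢ t
∈-∖⁻ R {t = t} = ∈-filter⁻ (λ s → ¬? (s ≟ᴺ t)) {xs = R}

∖-shrinks : ∀ {R t} → t ∈ R → length (R ∖ t) < length R
∖-shrinks {R} {t} t∈R = filter-notAll (λ s → ¬? (s ≟ᴺ t)) R (Any.map (λ t≡s s≢t → s≢t (sym t≡s)) t∈R)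

⊑-refl : ∀ u → u ⊑ u
⊑-refl u = [] , ++-identityʳ u

⊑-trans : ∀ {u v w} → u ⊑ v → v ⊑ w → u ⊑ w
⊑-trans {u} (r , refl) (r′ , refl) = r ++ r′ , sym (++-assoc u r r′)

⊑-antisym : ∀ {u v} → u ⊑ v → v ⊑ u → u ≡ v
⊑-antisym {u} (r , refl) (r′ , e)
  with ++-conicalˡ r r′ (++-identityʳ-unique u (sym (trans (sym (++-assoc u r r′)) e)))
... | refl = sym (++-identityʳ u)

⊏⇒⊑ : ∀ {u v} → u ⊏ v → u ⊑ v
⊏⇒⊑ (r , _ , e) = r , e

⊏-irrefl : ∀ {u} → ¬ (u ⊏ u)
⊏-irrefl {u} (r , r≢[] , e) = r≢[] (++-identityʳ-unique u (sym e))

⊑∧≢⇒⊏ : ∀ {u v} → u ⊑ v → u ≢ v → u ⊏ v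
⊑∧≢⇒⊏ {u} (r , e) u≢v = r , (λ { refl → u≢v (trans (sym (++-identityʳ u)) e) }) , e

⊑-⊏-trans : ∀ {u v w} → u ⊑ v → v ⊏ w → u ⊏ w
⊑-⊏-trans {u} (r , refl) (r′ , r′≢[] , refl) =
  r ++ r′ , (λ e → r′≢[] (++-conicalʳ r r′ e)) , sym (++-assoc u r r′)

⊏-∷ʳ : ∀ w i → w ⊏ (w ∷ʳ i)
⊏-∷ʳ w i = [ i ] , (λ ()) , refl

⊏⇒∷ʳ-⊑ : ∀ {u v} → u ⊏ v → ∃ λ i → (u ∷ʳ i) ⊑ v
⊏⇒∷ʳ-⊑ ([] , []≢[] , _) = contradiction refl []≢[]
⊏⇒∷ʳ-⊑ {u} (i ∷ r , _ , e) = i , r , trans (++-assoc u [ i ] r) e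

⊑-∷ʳ⁻ : ∀ {u w i} → u ⊑ (w ∷ʳ i) → u ≡ w ∷ʳ i ⊎ u ⊑ w
⊑-∷ʳ⁻ {u} {w} (r , e) with initLast r
... | []       = inj₁ (trans (sym (++-identityʳ u)) e)
... | r′ ∷ʳ′ j = inj₂ (r′ , proj₁ (∷ʳ-injective (u ++ r′) w (trans (++-assoc u r′ [ j ]) e)))

⊑-comparable : ∀ {u v w} → u ⊑ w → v ⊑ w → u ⊑ v ⊎ v ⊑ u
⊑-comparable {[]}    _ _ = inj₁ (_ , refl)
⊑-comparable {_ ∷ _} {[]} _ _ = inj₂ (_ , refl)
⊑-comparable {x ∷ u} {y ∷ v} (r , refl) (r′ , e) with ∷-injective e
... | refl , e′ with ⊑-comparable {u} {v} (r , refl) (r′ , e′)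
...   | inj₁ (d , p) = inj₁ (d , cong (x ∷_) p)
...   | inj₂ (d , p) = inj₂ (d , cong (x ∷_) p)

module _ {A : Set} (f : ℕ → A) where

  Recurrent : A → Set
  Recurrent v = ∀ k → ∃ λ n → k ≤ n × f n ≡ v

  ¬recurrent⇒eventually-avoided : ExcludedMiddle 0ℓ → ∀ {v} → ¬ Recurrent v →
                                  ∃ λ k → ∀ n → k ≤ n → f n ≢ v
  ¬recurrent⇒eventually-avoided em {v} ¬rec with em {∃ λ k → ∀ n → k ≤ n → f n ≢ v}
  ... | yes avoided = avoided
  ... | no ¬avoided = contradiction recurrent ¬rec
    where
    recurrent : Recurrent v
    recurrent k with em {∃ λ n → k ≤ n × f n ≡ v}
    ... | yes visit = visit
    ... | no ¬visit = contradiction (k , λ n k≤n fn≡v → ¬visit (n , k≤n , fn≡v)) ¬avoided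

  eventually-recurrent : ExcludedMiddle 0ℓ → (L : List A) → (∀ n → f n ∈ L) →
                         ∃ λ m → ∀ n → m ≤ n → Recurrent (f n)
  eventually-recurrent em L f∈L = let m , rec = go L in m , λ n m≤n → rec n m≤n (f∈L n)
    where
    go : ∀ L → ∃ λ m → ∀ n → m ≤ n → f n ∈ L → Recurrent (f n)
    go []      = 0 , λ _ _ ()
    go (v ∷ L) with go L | em {Recurrent v}
    ... | m , rec | yes rec-v = m , λ where
      n _   (here fn≡v)  → subst Recurrent (sym fn≡v) rec-v
      n m≤n (there fn∈L) → rec n m≤n fn∈L
    ... | m , rec | no ¬rec-v = let k , avoid = ¬recurrent⇒eventually-avoided em ¬rec-v in
      m + k , λ where
        n m+k≤n (here fn≡v)  → contradiction fn≡v (avoid n (≤-trans (m≤n+m k m) m+k≤n))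
        n m+k≤n (there fn∈L) → rec n (≤-trans (m≤m+n m k) m+k≤n) fn∈L

  recurrent-window : (L : List A) → All Recurrent L → ∀ k →
                     ∃ λ N → k ≤ N × All (λ v → ∃ λ j → k ≤ j × j ≤ N × f j ≡ v) L
  recurrent-window []      []              k = k , ≤-refl , []
  recurrent-window (v ∷ L) (rec-v ∷ rec-L) k with recurrent-window L rec-L k | rec-v k
  ... | N , k≤N , visits | n , k≤n , fn≡v =
    N + n , ≤-trans k≤N (m≤m+n N n) ,
    (n , k≤n , m≤n+m n N , fn≡v) ∷
    All.map (λ (j , k≤j , j≤N , fj≡) → j , k≤j , ≤-trans j≤N (m≤m+n N n) , fj≡) visits

module Walks (π : PreProof) where
  open PreProof π
  open CyclicTree tree
  open Equivalence

  ⊏⇒not-bud : ∀ {u v} → u ⊏ v → v ∈ T → β u ≡ nothing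
  ⊏⇒not-bud {u} u⊏v v∈T with β u in eq
  ... | nothing = refl
  ... | just _  = let i , ui⊑v = ⊏⇒∷ʳ-⊑ u⊏v in
                  contradiction (prefix-closed v∈T ui⊑v) (proj₂ (bud-leaf eq) i)

  bud∈T : ∀ {s} → InDom π s → s ∈ T
  bud∈T (_ , eq) = proj₁ (bud-leaf eq)

  bud∈cycle : ∀ {s} → InDom π s → InCycle π s s
  bud∈cycle {s} (c , eq) = c , eq , ⊏⇒⊑ (normal-form eq) , ⊑-refl s

  cycle⇒bud : ∀ {s u} → InCycle π s u → InDom π s
  cycle⇒bud (c , eq , _) = c , eq

  cycle⊆T : ∀ {s u} → InCycle π s u → u ∈ T
  cycle⊆T (c , eq , _ , u⊑s) = prefix-closed (bud∈T (c , eq)) u⊑s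

  InC⊆T : ∀ {η u} → InC π η u → u ∈ T
  InC⊆T (_ , _ , cyc) = cycle⊆T cyc

  inDom? : ∀ s → Dec (InDom π s)
  inDom? s with β s
  ... | just c  = yes (c , refl)
  ... | nothing = no λ ()

  InC-mono : ∀ {η η′ u} → η ⊆ η′ → InC π η u → InC π η′ u
  InC-mono η⊆η′ (s , s∈η , cyc) = s , η⊆η′ s∈η , cyc

  InC-++⁻ : ∀ η₁ {η₂ u} → InC π (η₁ ++ η₂) u → InC π η₁ u ⊎ InC π η₂ u
  InC-++⁻ η₁ (s , s∈η , cyc) with ∈-++⁻ η₁ s∈η
  ... | inj₁ s∈η₁ = inj₁ (s , s∈η₁ , cyc)
  ... | inj₂ s∈η₂ = inj₂ (s , s∈η₂ , cyc)

  -- Walk a b ys: a path from a to b whose nodes after a are ys.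
  data Walk : Node → Node → List Node → Set where
    []  : ∀ {a} → Walk a a []
    _∷_ : ∀ {a u b ys} → Step π a u → Walk u b ys → Walk a b (u ∷ ys)

  _++ʷ_ : ∀ {a b c ys zs} → Walk a b ys → Walk b c zs → Walk a c (ys ++ zs)
  []      ++ʷ w′ = w′
  (s ∷ w) ++ʷ w′ = s ∷ (w ++ʷ w′)

  target∈ : ∀ {a b ys} → Walk a b ys → b ∈ a ∷ ys
  target∈ []      = here refl
  target∈ (_ ∷ w) = there (target∈ w)

  splitʷ : ∀ {a b ys u} → Walk a b ys → u ∈ a ∷ ys →
           ∃ λ ys₁ → ∃ λ ys₂ → Walk a u ys₁ × Walk u b ys₂ × ys ≡ ys₁ ++ ys₂
  splitʷ w       (here refl) = [] , _ , [] , w , refl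
  splitʷ (s ∷ w) (there u∈)  =
    let ys₁ , ys₂ , w₁ , w₂ , e = splitʷ w u∈ in _ ∷ ys₁ , ys₂ , s ∷ w₁ , w₂ , cong (_ ∷_) e

  path⇒walk : ∀ {t ps} → Path π (t ∷ ps) → ∃ λ b → last (t ∷ ps) ≡ just b × Walk t b ps
  path⇒walk (one t)    = t , refl , []
  path⇒walk (step s p) = let b , e , w = path⇒walk p in b , e , s ∷ w

  walk⇒path : ∀ {a b ys} → Walk a b ys → Path π (a ∷ ys) × last (a ∷ ys) ≡ just b
  walk⇒path []      = one _ , refl
  walk⇒path (s ∷ w) = let p , e = walk⇒path w in step s p , e

  descent : ∀ r {p v} → p ++ r ≡ v → v ∈ T →
            ∃ λ ys → Walk p v ys × (∀ u → u ∈ p ∷ ys ⇔ (p ⊑ u × u ⊑ v))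
  descent [] {p} e _ with trans (sym (++-identityʳ p)) e
  ... | refl = [] , [] , λ u → mk⇔
    (λ { (here refl) → ⊑-refl p , ⊑-refl p })
    (λ (p⊑u , u⊑p) → here (⊑-antisym u⊑p p⊑u))
  descent (i ∷ r) {p} {v} e v∈T with descent r (trans (++-assoc p [ i ] r) e) v∈T
  ... | ys , w , interval =
    (p ∷ʳ i) ∷ ys , inj₁ (⊏⇒not-bud p⊏v v∈T , (i , refl) , prefix-closed v∈T pi⊑v) ∷ w ,
    λ u → mk⇔ (to′ u) (from′ u)
    where
    p⊏v : p ⊏ v
    p⊏v = i ∷ r , (λ ()) , e
    pi⊑v : (p ∷ʳ i) ⊑ v
    pi⊑v = r , trans (++-assoc p [ i ] r) e
    to′ : ∀ u → u ∈ p ∷ (p ∷ʳ i) ∷ ys → p ⊑ u × u ⊑ v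
    to′ u (here refl) = ⊑-refl p , ⊏⇒⊑ p⊏v
    to′ u (there u∈)  = let pi⊑u , u⊑v = to (interval u) u∈ in
                        ⊑-trans (⊏⇒⊑ (⊏-∷ʳ p i)) pi⊑u , u⊑v
    from′ : ∀ u → p ⊑ u × u ⊑ v → u ∈ p ∷ (p ∷ʳ i) ∷ ys
    from′ u (p⊑u , u⊑v) with ⊑-comparable u⊑v pi⊑v
    ... | inj₂ pi⊑u = there (from (interval u) (pi⊑u , u⊑v))
    ... | inj₁ u⊑pi with ⊑-∷ʳ⁻ u⊑pi
    ...   | inj₁ refl = there (here refl)
    ...   | inj₂ u⊑p  = here (⊑-antisym u⊑p p⊑u)

  uncons : ∀ {a b v ys} → Walk a b (v ∷ ys) → Step π a v × Walk v b ys
  uncons (s ∷ w) = s , w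

  record Circuit (η : List Node) (a : Node) : Set where
    field
      route  : List Node
      closed : Walk a a route
      nodes  : ∀ u → u ∈ a ∷ route ⇔ InC π η u

  open Equivalence

  sc⇒circuit : ∀ {η} → StronglyConnected π η → ∃ (Circuit η)
  sc⇒circuit (_ , []     , ()   , _)
  sc⇒circuit (_ , t ∷ ps , path , head≡last , nodes) with path⇒walk path
  ... | b , last≡b , w with just-injective (trans head≡last last≡b)
  ...   | refl = t , record { route = ps ; closed = w ; nodes = nodes }

  circuit⇒sc : ∀ {η a} → All (InDom π) η → Circuit η a → StronglyConnected π η
  circuit⇒sc {a = a} buds C =
    buds , a ∷ route , proj₁ (walk⇒path closed) , sym (proj₂ (walk⇒path closed)) , nodes
    where open Circuit C

  sc-nonempty : ∀ {η} → StronglyConnected π η → ∃ λ s → s ∈ η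
  sc-nonempty (_ , []    , () , _)
  sc-nonempty (_ , t ∷ _ , _  , _ , nodes) = let s , s∈η , _ = to (nodes t) (here refl) in s , s∈η

  rotate : ∀ {η a s} (C : Circuit η a) → s ∈ a ∷ Circuit.route C → Circuit η s
  rotate {a = a} C s∈C with splitʷ (Circuit.closed C) s∈C
  ... | ys₁ , ys₂ , w₁ , w₂ , route≡ = record
    { route  = ys₂ ++ ys₁
    ; closed = w₂ ++ʷ w₁
    ; nodes  = λ u → mk⇔
        (λ u∈ → to (nodes u) (subst (λ ys → u ∈ a ∷ ys) (sym route≡) (rotate-⊆ (target∈ w₁) u∈)))
        (λ i → rotate-⊆ (target∈ w₂) (subst (λ ys → u ∈ a ∷ ys) route≡ (from (nodes u) i)))
    }
    where open Circuit C

  circuit-++ : ∀ {η₁ η₂ s} → Circuit η₁ s → Circuit η₂ s → Circuit (η₁ ++ η₂) s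
  circuit-++ {η₁} {η₂} {s} C₁ C₂ = record
    { route  = route C₁ ++ route C₂
    ; closed = closed C₁ ++ʷ closed C₂
    ; nodes  = λ u → mk⇔ (to′ u) (from′ u)
    }
    where
    open Circuit
    to′ : ∀ u → u ∈ s ∷ route C₁ ++ route C₂ → InC π (η₁ ++ η₂) u
    to′ u (here refl) = InC-mono (xs⊆xs++ys η₁ η₂) (to (nodes C₁ u) (here refl))
    to′ u (there u∈) with ∈-++⁻ (route C₁) u∈
    ... | inj₁ u∈₁ = InC-mono (xs⊆xs++ys η₁ η₂) (to (nodes C₁ u) (there u∈₁))
    ... | inj₂ u∈₂ = InC-mono (xs⊆ys++xs η₂ η₁) (to (nodes C₂ u) (there u∈₂))
    from′ : ∀ u → InC π (η₁ ++ η₂) u → u ∈ s ∷ route C₁ ++ route C₂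
    from′ u i with InC-++⁻ η₁ i
    ... | inj₁ i₁ = xs⊆xs++ys (s ∷ route C₁) (route C₂) (from (nodes C₁ u) i₁)
    ... | inj₂ i₂ = ∷⁺ʳ s (xs⊆ys++xs (route C₂) (route C₁)) (from (nodes C₂ u) i₂)

  cycle-circuit : ∀ {s c} → β s ≡ just c → Circuit [ s ] c
  cycle-circuit {s} {c} eq with ⊏⇒⊑ (normal-form eq)
  ... | r , e with descent r e (bud∈T (c , eq))
  ...   | ys , w , interval = record
    { route  = ys ++ [ c ]
    ; closed = w ++ʷ (inj₂ eq ∷ [])
    ; nodes  = λ u → mk⇔ (to′ u) (from′ u)
    }
    where
    in-cycle : ∀ {u} → c ⊑ u × u ⊑ s → InC π [ s ] u
    in-cycle (c⊑u , u⊑s) = s , here refl , c , eq , c⊑u , u⊑s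
    to′ : ∀ u → u ∈ c ∷ ys ++ [ c ] → InC π [ s ] u
    to′ u u∈ with ∈-++⁻ (c ∷ ys) u∈
    ... | inj₁ u∈ys        = in-cycle (to (interval u) u∈ys)
    ... | inj₂ (here refl) = in-cycle (to (interval c) (here refl))
    from′ : ∀ u → InC π [ s ] u → u ∈ c ∷ ys ++ [ c ]
    from′ u (_ , here refl , c′ , eq′ , c′⊑u , u⊑s) with just-injective (trans (sym eq) eq′)
    ... | refl = xs⊆xs++ys (c ∷ ys) [ c ] (from (interval u) (c′⊑u , u⊑s))

  sc-singleton : ∀ {s} → InDom π s → StronglyConnected π [ s ]
  sc-singleton (c , eq) = circuit⇒sc ((c , eq) ∷ []) (cycle-circuit eq)

  sc-++ : ∀ {η₁ η₂ s} → StronglyConnected π η₁ → StronglyConnected π η₂ → s ∈ η₁ → s ∈ η₂ →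
          StronglyConnected π (η₁ ++ η₂)
  sc-++ sc₁ sc₂ s∈η₁ s∈η₂ =
    circuit⇒sc (Allₚ.++⁺ (proj₁ sc₁) (proj₁ sc₂)) (circuit-++ (based-at sc₁ s∈η₁) (based-at sc₂ s∈η₂))
    where
    based-at : ∀ {η s} → StronglyConnected π η → s ∈ η → Circuit η s
    based-at {s = s} sc s∈η with sc⇒circuit sc
    ... | _ , C = rotate C (from (Circuit.nodes C s) (s , s∈η , bud∈cycle (All.lookup (proj₁ sc) s∈η)))

  -- A circuit passes through a bud and its companion, which are distinct.
  circuit-route≢[] : ∀ {η a} (C : Circuit η a) → Circuit.route C ≢ []
  circuit-route≢[] {a = a} C route≡[] with to (Circuit.nodes C a) (here refl)
  ... | s , s∈η , c , eq , _ =
    ⊏-irrefl (subst (_⊏ s) (trans (only-a c∈C) (sym (only-a s∈C))) (normal-form eq))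
    where
    open Circuit C
    only-a : ∀ {u} → u ∈ a ∷ route → u ≡ a
    only-a (here u≡a)  = u≡a
    only-a (there u∈) = case subst (_ ∈_) route≡[] u∈ of λ ()
    s∈C : s ∈ a ∷ route
    s∈C = from (nodes s) (s , s∈η , bud∈cycle (c , eq))
    c∈C : c ∈ a ∷ route
    c∈C = from (nodes c) (s , s∈η , c , eq , ⊑-refl c , ⊏⇒⊑ (normal-form eq))

  -- The infinite branch that descends from the root to a and then goes round loop forever.
  module Lasso {a v ys} (a∈T : a ∈ T) (loop : Walk a a (v ∷ ys)) where

    zs : List Node
    zs = proj₁ (descent a refl a∈T)

    stem : Walk [] a zs
    stem = proj₁ (proj₂ (descent a refl a∈T))

    State : Set
    State = ∃ λ u → ∃ λ xs → Walk u a xs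

    next : State → State
    next (_ , _ , _ ∷ w) = _ , _ , w
    next (_ , _ , [])    = v , ys , proj₂ (uncons loop)

    next-step : ∀ σ → Step π (proj₁ σ) (proj₁ (next σ))
    next-step (_ , _ , s ∷ _) = s
    next-step (_ , _ , [])    = proj₁ (uncons loop)

    run : ℕ → State → State
    run zero    σ = σ
    run (suc n) σ = run n (next σ)

    run-suc : ∀ n σ → run (suc n) σ ≡ next (run n σ)
    run-suc zero    σ = refl
    run-suc (suc n) σ = run-suc n (next σ)

    run-+ : ∀ m k σ → run (m + k) σ ≡ run k (run m σ)
    run-+ zero    k σ = refl
    run-+ (suc m) k σ = run-+ m k (next σ)

    run-to-end : ∀ {u xs} (w : Walk u a xs) → run (length xs) (u , xs , w) ≡ (a , [] , [])
    run-to-end []      = refl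
    run-to-end (_ ∷ w) = run-to-end w

    run-visits : ∀ {u xs} (w : Walk u a xs) {x} → x ∈ u ∷ xs → ∃ λ j → proj₁ (run j (u , xs , w)) ≡ x
    run-visits w       (here refl) = 0 , refl
    run-visits (_ ∷ w) (there x∈)  = let j , e = run-visits w x∈ in suc j , e

    reaches : ∀ σ {x} → x ∈ a ∷ v ∷ ys → ∃ λ k → proj₁ (run k σ) ≡ x
    reaches (_ , xs , w) (here refl) = length xs , cong proj₁ (run-to-end w)
    reaches (_ , xs , w) (there x∈)  =
      let j , e = run-visits (proj₂ (uncons loop)) x∈ in
      length xs + suc j ,
      trans (cong proj₁ (trans (run-+ (length xs) (suc j) _) (cong (run (suc j)) (run-to-end w)))) e

    InLoop : State → Set
    InLoop (u , xs , _) = u ∈ a ∷ v ∷ ys × xs ⊆ a ∷ v ∷ ys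

    run-InLoop : ∀ k σ → InLoop σ → InLoop (run k σ)
    run-InLoop zero    σ               inσ        = inσ
    run-InLoop (suc k) (_ , _ , _ ∷ _) (_ , xs⊆) =
      run-InLoop k _ (xs⊆ (here refl) , λ x∈ → xs⊆ (there x∈))
    run-InLoop (suc k) (_ , _ , [])    _          =
      run-InLoop k _ (there (here refl) , λ x∈ → there (there x∈))

    σ₀ : State
    σ₀ = [] , zs , stem

    branch : ℕ → Node
    branch n = proj₁ (run n σ₀)

    branch-infinite : InfiniteBranch π branch
    branch-infinite = refl , λ n →
      subst (λ σ → Step π (branch n) (proj₁ σ)) (sym (run-suc n σ₀)) (next-step (run n σ₀))

    loop-recurrent : ∀ {x} → x ∈ a ∷ v ∷ ys → Recurrent branch x
    loop-recurrent x∈ m =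
      let k , e = reaches (run m σ₀) x∈ in m + k , m≤m+n m k , trans (cong proj₁ (run-+ m k σ₀)) e

    eventually-in-loop : ∀ n → length zs ≤ n → branch n ∈ a ∷ v ∷ ys
    eventually-in-loop n zs≤n =
      let k , zs+k≡n = m≤n⇒∃[o]m+o≡n zs≤n
          after-stem = trans (run-+ (length zs) k σ₀) (cong (run k) (run-to-end stem))
      in subst (λ n → branch n ∈ a ∷ v ∷ ys) zs+k≡n
           (subst (λ σ → proj₁ σ ∈ a ∷ v ∷ ys) (sym after-stem)
             (proj₁ (run-InLoop k (a , [] , []) (here refl , λ ()))))

    proof-along-loop : IsProof π →
                       ∃ λ x → (∀ {u} → u ∈ a ∷ v ∷ ys → x ∈FVˢ λˢ π u) ×
                               ∃ λ u → u ∈ a ∷ v ∷ ys × β u ≡ nothing × IsCase x (ρ u)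
    proof-along-loop proof with proof branch branch-infinite
    ... | x , (m , free) , cases = x , free-on-loop , case-on-loop
      where
      free-on-loop : ∀ {u} → u ∈ a ∷ v ∷ ys → x ∈FVˢ λˢ π u
      free-on-loop u∈ = let n , m≤n , bn≡u = loop-recurrent u∈ m in
                        subst (λ u → x ∈FVˢ λˢ π u) bn≡u (free n m≤n)
      case-on-loop : ∃ λ u → u ∈ a ∷ v ∷ ys × β u ≡ nothing × IsCase x (ρ u)
      case-on-loop = let n , zs≤n , not-bud , is-case = cases (length zs) in
                     branch n , eventually-in-loop n zs≤n , not-bud , is-case

module ProofToOrder (π : PreProof) where
  open PreProof π
  open CyclicTree tree
  open Equivalence
  open Walks π

  CaseAlong : Node → Var → Set
  CaseAlong s x = ∃ λ u → InCycle π s u × u ≢ s × IsCase x (ρ u)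

  case-variable : IsProof π → ∀ {η} → StronglyConnected π η →
                  ∃ λ x → (∀ {u} → InC π η u → x ∈FVˢ λˢ π u) × ∃ λ t → t ∈ η × CaseAlong t x
  case-variable proof sc with sc⇒circuit sc
  ... | a , C with Circuit.route C | Circuit.closed C | Circuit.nodes C | circuit-route≢[] C
  ...   | []     | _    | _     | moves = contradiction refl moves
  ...   | v ∷ ys | loop | nodes | _
    with Lasso.proof-along-loop (InC⊆T (to (nodes a) (here refl))) loop proof
  ... | x , free , u , u∈loop , not-bud , is-case with to (nodes u) u∈loop
  ... | t , t∈η , cyc@(_ , bud , _) =
    x , (λ i → free (from (nodes _) i)) , t , t∈η , u , cyc , u≢t , is-case
    where
    u≢t : u ≢ t
    u≢t refl = case trans (sym not-bud) bud of λ ()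

  Linked : List Node → Node → Node → Set
  Linked R s t = ∃ λ η → η ⊆ R × StronglyConnected π η × s ∈ η × t ∈ η

  linked-refl : ∀ {R s} → s ∈ R → InDom π s → Linked R s s
  linked-refl s∈R bud = [ _ ] , (λ { (here refl) → s∈R }) , sc-singleton bud , here refl , here refl

  linked-trans : ∀ {R s t u} → Linked R s t → Linked R t u → Linked R s u
  linked-trans (η₁ , η₁⊆R , sc₁ , s∈η₁ , t∈η₁) (η₂ , η₂⊆R , sc₂ , t∈η₂ , u∈η₂) =
    η₁ ++ η₂ , ++-⊆ η₁⊆R η₂⊆R , sc-++ sc₁ sc₂ t∈η₁ t∈η₂ , ∈-++⁺ˡ s∈η₁ , ∈-++⁺ʳ η₁ u∈η₂

  linked-mono : ∀ {R R′ s t} → R ⊆ R′ → Linked R s t → Linked R′ s t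
  linked-mono R⊆R′ (η , η⊆R , sc , s∈η , t∈η) = η , (λ x∈ → R⊆R′ (η⊆R x∈)) , sc , s∈η , t∈η

  linked-∈ˡ : ∀ {R s t} → Linked R s t → s ∈ R
  linked-∈ˡ (_ , η⊆R , _ , s∈η , _) = η⊆R s∈η

  linked-∈ʳ : ∀ {R s t} → Linked R s t → t ∈ R
  linked-∈ʳ (_ , η⊆R , _ , _ , t∈η) = η⊆R t∈η

  record InductionOrderOn (R : List Node) : Set₁ where
    field
      _≼_        : Node → Node → Set
      xv         : Node → Var
      ≼-refl     : ∀ {s} → s ∈ R → s ≼ s
      ≼-trans    : ∀ {s t u} → s ≼ t → t ≼ u → s ≼ u
      ≼⇒linked   : ∀ {s t} → s ≼ t → Linked R s t
      ≼-free     : ∀ {s t} → s ≼ t → ∀ {u} → InCycle π s u → xv t ∈FVˢ λˢ π u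
      case-along : ∀ {s} → s ∈ R → CaseAlong s (xv s)
      sc-max     : ∀ η → η ⊆ R → StronglyConnected π η → ∃ λ s → s ∈ η × (∀ {t} → t ∈ η → t ≼ s)

  empty-order : InductionOrderOn []
  empty-order = record
    { _≼_ = λ _ _ → ⊥ ; xv = λ _ → 0
    ; ≼-refl = λ () ; ≼-trans = λ () ; ≼⇒linked = λ () ; ≼-free = λ () ; case-along = λ ()
    ; sc-max = λ η η⊆[] sc → case η⊆[] (proj₂ (sc-nonempty sc)) of λ ()
    }

  module Extend {R t x} (t∈R : t ∈ R) (free : ∀ {s u} → Linked R s t → InCycle π s u → x ∈FVˢ λˢ π u)
                (is-case : CaseAlong t x) (O : InductionOrderOn (R ∖ t)) where
    open InductionOrderOn O renaming
      (_≼_ to _≼′_; xv to xv′; ≼-refl to ≼′-refl; ≼-trans to ≼′-trans; ≼⇒linked to ≼′⇒linked;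
       ≼-free to ≼′-free; case-along to case-along′; sc-max to sc-max′)

    R∖t⊆R : R ∖ t ⊆ R
    R∖t⊆R s∈ = proj₁ (∈-∖⁻ R s∈)

    _≼_ : Node → Node → Set
    s ≼ v = s ≼′ v ⊎ (v ≡ t × Linked R s t)

    xv : Node → Var
    xv s with s ≟ᴺ t
    ... | yes _ = x
    ... | no  _ = xv′ s

    xv-t : xv t ≡ x
    xv-t with t ≟ᴺ t
    ... | yes _   = refl
    ... | no  t≢t = contradiction refl t≢t

    xv-≢ : ∀ {s} → s ≢ t → xv s ≡ xv′ s
    xv-≢ {s} s≢t with s ≟ᴺ t
    ... | yes s≡t = contradiction s≡t s≢t
    ... | no  _   = refl

    ≼-refl : ∀ {s} → s ∈ R → s ≼ s
    ≼-refl {s} s∈R with s ≟ᴺ t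
    ... | yes refl = inj₂ (refl , linked-refl t∈R (cycle⇒bud (proj₁ (proj₂ is-case))))
    ... | no  s≢t  = inj₁ (≼′-refl (∈-∖⁺ s∈R s≢t))

    ≼-trans : ∀ {s v w} → s ≼ v → v ≼ w → s ≼ w
    ≼-trans (inj₁ p)          (inj₁ q)         = inj₁ (≼′-trans p q)
    ≼-trans (inj₁ p)          (inj₂ (w≡t , l)) =
      inj₂ (w≡t , linked-trans (linked-mono R∖t⊆R (≼′⇒linked p)) l)
    ≼-trans (inj₂ (refl , _)) (inj₁ q)         =
      contradiction refl (proj₂ (∈-∖⁻ R (linked-∈ˡ (≼′⇒linked q))))
    ≼-trans (inj₂ (refl , l)) (inj₂ (w≡t , _)) = inj₂ (w≡t , l)

    ≼⇒linked : ∀ {s v} → s ≼ v → Linked R s v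
    ≼⇒linked (inj₁ p)          = linked-mono R∖t⊆R (≼′⇒linked p)
    ≼⇒linked (inj₂ (refl , l)) = l

    ≼-free : ∀ {s v} → s ≼ v → ∀ {u} → InCycle π s u → xv v ∈FVˢ λˢ π u
    ≼-free (inj₁ p) {u} cyc =
      subst (λ y → y ∈FVˢ λˢ π u) (sym (xv-≢ (proj₂ (∈-∖⁻ R (linked-∈ʳ (≼′⇒linked p)))))) (≼′-free p cyc)
    ≼-free (inj₂ (refl , l)) {u} cyc = subst (λ y → y ∈FVˢ λˢ π u) (sym xv-t) (free l cyc)

    case-along : ∀ {s} → s ∈ R → CaseAlong s (xv s)
    case-along {s} s∈R with s ≟ᴺ t
    ... | yes refl = is-case
    ... | no  s≢t  = case-along′ (∈-∖⁺ s∈R s≢t)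

    sc-max : ∀ η → η ⊆ R → StronglyConnected π η → ∃ λ s → s ∈ η × (∀ {v} → v ∈ η → v ≼ s)
    sc-max η η⊆R sc with Any.any? (t ≟ᴺ_) η
    ... | yes t∈η = t , t∈η , λ v∈η → inj₂ (refl , η , η⊆R , sc , v∈η , t∈η)
    ... | no  t∉η =
      let s , s∈η , max = sc-max′ η (λ v∈η → ∈-∖⁺ (η⊆R v∈η) λ { refl → t∉η v∈η }) sc
      in s , s∈η , λ v∈η → inj₁ (max v∈η)

    order : InductionOrderOn R
    order = record
      { _≼_ = _≼_ ; xv = xv ; ≼-refl = ≼-refl ; ≼-trans = ≼-trans ; ≼⇒linked = ≼⇒linked
      ; ≼-free = ≼-free ; case-along = case-along ; sc-max = sc-max }

  linked-class : ExcludedMiddle 0ℓ → ∀ {R s₀} → s₀ ∈ R → InDom π s₀ →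
                 ∃ λ K → K ⊆ R × StronglyConnected π K × s₀ ∈ K × (∀ {s} → Linked R s s₀ → s ∈ K)
  linked-class em {R} {s₀} s₀∈R bud =
    let K , K⊆R , scK , s₀∈K , covers = go R in K , K⊆R , scK , s₀∈K , λ l → covers (linked-∈ˡ l) l
    where
    go : ∀ L → ∃ λ K → K ⊆ R × StronglyConnected π K × s₀ ∈ K × (∀ {s} → s ∈ L → Linked R s s₀ → s ∈ K)
    go []      = [ s₀ ] , (λ { (here refl) → s₀∈R }) , sc-singleton bud , here refl , λ ()
    go (s ∷ L) with go L | em {Linked R s s₀}
    ... | K , K⊆R , scK , s₀∈K , covers | no ¬l =
      K , K⊆R , scK , s₀∈K , λ { (here refl) l → contradiction l ¬l ; (there s′∈L) → covers s′∈L }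
    ... | K , K⊆R , scK , s₀∈K , covers | yes (η , η⊆R , scη , s∈η , s₀∈η) =
      K ++ η , ++-⊆ K⊆R η⊆R , sc-++ scK scη s₀∈K s₀∈η , ∈-++⁺ˡ s₀∈K ,
      λ { (here refl) _ → ∈-++⁺ʳ K s∈η ; (there s′∈L) l → ∈-++⁺ˡ (covers s′∈L l) }

  order-on : ExcludedMiddle 0ℓ → IsProof π → ∀ n R → length R ≤ n → (∀ {s} → s ∈ R → InDom π s) →
             InductionOrderOn R
  order-on _  _     _       []       _         _    = empty-order
  order-on em proof (suc n) (s₀ ∷ R) (s≤s |R|≤n) buds
    with linked-class em (here refl) (buds (here refl))
  ... | K , K⊆R , scK , s₀∈K , linked⇒∈K with case-variable proof scK
  ... | x , free , t , t∈K , is-case =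
    Extend.order (K⊆R t∈K) free-on-class is-case
      (order-on em proof n ((s₀ ∷ R) ∖ t) shrunk (λ s∈ → buds (proj₁ (∈-∖⁻ (s₀ ∷ R) s∈))))
    where
    free-on-class : ∀ {s u} → Linked (s₀ ∷ R) s t → InCycle π s u → x ∈FVˢ λˢ π u
    free-on-class l cyc = free (_ , linked⇒∈K (linked-trans l (K , K⊆R , scK , t∈K , s₀∈K)) , cyc)
    shrunk : length ((s₀ ∷ R) ∖ t) ≤ n
    shrunk = ≤-pred (≤-trans (∖-shrinks (K⊆R t∈K)) (s≤s |R|≤n))

  proof⇒induction-order : ExcludedMiddle 0ℓ → IsProof π → InductionOrder π
  proof⇒induction-order em proof = record
    { _⪯_        = _≼_
    ; xv         = xv
    ; ⪯-refl     = λ bud → ≼-refl (∈buds bud)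
    ; ⪯-trans    = λ _ _ _ → ≼-trans
    ; xv-free    = λ bud → ≼-free (≼-refl (∈buds bud)) (bud∈cycle bud)
    ; order-free = λ _ _ → ≼-free
    ; case-along = λ bud → case-along (∈buds bud)
    ; sc-max     = λ η sc → sc-max η (λ s∈η → ∈buds (All.lookup (proj₁ sc) s∈η)) sc
    }
    where
    buds : List Node
    buds = filter inDom? T
    ∈buds : ∀ {s} → InDom π s → s ∈ buds
    ∈buds bud = ∈-filter⁺ inDom? (bud∈T bud) bud
    open InductionOrderOn
      (order-on em proof (length buds) buds ≤-refl (λ s∈ → proj₂ (∈-filter⁻ inDom? {xs = T} s∈)))

module OrderToProof (π : PreProof) (b : ℕ → Node) (infinite : InfiniteBranch π b) where
  open PreProof π
  open CyclicTree tree
  open Equivalence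
  open Walks π

  branch-step : ∀ n → Step π (b n) (b (suc n))
  branch-step = proj₂ infinite

  branch∈T : ∀ n → b n ∈ T
  branch∈T zero    = subst (_∈ T) (sym (proj₁ infinite)) root∈T
  branch∈T (suc n) with branch-step n
  ... | inj₁ (_ , _ , child∈T) = child∈T
  ... | inj₂ jump              = proj₁ (comp-inner jump)

  bud-successor : ∀ {n s c} → b n ≡ s → β s ≡ just c → b (suc n) ≡ c
  bud-successor {n} refl eq with branch-step n
  ... | inj₁ (not-bud , _) = case trans (sym not-bud) eq of λ ()
  ... | inj₂ jump          = just-injective (trans (sym jump) eq)

  visits-between : ∀ {m n u} → m ≤′ n → b m ⊑ u → u ⊑ b n → ∃ λ j → m ≤ j × b j ≡ u
  visits-between ≤′-refl bm⊑u u⊑bn = _ , ≤-refl , ⊑-antisym bm⊑u u⊑bn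
  visits-between {u = u} (≤′-step {n} m≤n) bm⊑u u⊑bsn with branch-step n
  ... | inj₂ jump = visits-between m≤n bm⊑u (⊑-trans u⊑bsn (⊏⇒⊑ (normal-form jump)))
  ... | inj₁ (_ , (i , bsn≡) , _) with ⊑-∷ʳ⁻ (subst (u ⊑_) bsn≡ u⊑bsn)
  ...   | inj₁ u≡   = suc n , ≤-trans (≤′⇒≤ m≤n) (n≤1+n n) , trans bsn≡ (sym u≡)
  ...   | inj₂ u⊑bn = visits-between m≤n bm⊑u u⊑bn

  recurrent-cycle : ∀ {s u} → Recurrent b s → InCycle π s u → Recurrent b u
  recurrent-cycle rec (c , eq , c⊑u , u⊑s) k with rec k
  ... | n₁ , k≤n₁ , bn₁≡s with rec (suc n₁)
  ...   | n₂ , n₁<n₂ , bn₂≡s =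
    let j , sn₁≤j , bj≡u = visits-between (≤⇒≤′ n₁<n₂)
                             (subst (_⊑ _) (sym (bud-successor bn₁≡s eq)) c⊑u)
                             (subst (_ ⊑_) (sym bn₂≡s) u⊑s)
    in j , ≤-trans k≤n₁ (≤-trans (n≤1+n n₁) sn₁≤j) , bj≡u

  -- The only way back up to (or above) v is a jump from a bud to a companion c ⊑ v.
  below-or-returned : ∀ {n v} → v ⊑ b n → v ⊏ b (suc n) ⊎ InCycle π (b n) v
  below-or-returned {n} {v} v⊑bn with branch-step n
  ... | inj₁ (_ , (i , e) , _) = inj₁ (subst (v ⊏_) (sym e) (⊑-⊏-trans v⊑bn (⊏-∷ʳ (b n) i)))
  ... | inj₂ jump with ⊑-comparable (⊏⇒⊑ (normal-form jump)) v⊑bn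
  ...   | inj₁ c⊑v = inj₂ (_ , jump , c⊑v , v⊑bn)
  ...   | inj₂ v⊑c with v ≟ᴺ b (suc n)
  ...     | yes v≡c = inj₂ (_ , jump , subst (_⊑ v) v≡c (⊑-refl v) , v⊑bn)
  ...     | no  v≢c = inj₁ (⊑∧≢⇒⊏ v⊑c v≢c)

  stays-below-or-returns : ∀ {n m v} → b n ≡ v → suc n ≤′ m →
                           v ⊏ b m ⊎ ∃ λ j → n ≤ j × InCycle π (b j) v
  stays-below-or-returns {n} {v = v} bn≡v ≤′-refl
    with below-or-returned {n} (subst (v ⊑_) (sym bn≡v) (⊑-refl v))
  ... | inj₁ below = inj₁ below
  ... | inj₂ cyc   = inj₂ (n , ≤-refl , cyc)
  stays-below-or-returns bn≡v (≤′-step {m} sn≤m) with stays-below-or-returns bn≡v sn≤m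
  ... | inj₂ returned = inj₂ returned
  ... | inj₁ v⊏bm with below-or-returned (⊏⇒⊑ v⊏bm)
  ...   | inj₁ below = inj₁ below
  ...   | inj₂ cyc   = inj₂ (m , ≤-trans (n≤1+n _) (≤′⇒≤ sn≤m) , cyc)

  recurrent⇒on-cycle : ∀ {n v} → Recurrent b v → b n ≡ v → ∃ λ j → n ≤ j × InCycle π (b j) v
  recurrent⇒on-cycle {n} {v} rec bn≡v with rec (suc n)
  ... | m , sn≤m , bm≡v with stays-below-or-returns bn≡v (≤⇒≤′ sn≤m)
  ...   | inj₁ v⊏bm     = contradiction (subst (v ⊏_) bm≡v v⊏bm) ⊏-irrefl
  ...   | inj₂ returned = returned

  branch-walk : ∀ {m n} → m ≤′ n →
                ∃ λ ys → Walk (b m) (b n) ys × (∀ {u} → u ∈ b m ∷ ys → ∃ λ j → m ≤ j × b j ≡ u)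
                                              × (∀ {j} → m ≤ j → j ≤ n → b j ∈ b m ∷ ys)
  branch-walk {m} ≤′-refl =
    [] , [] , (λ { (here refl) → m , ≤-refl , refl }) , λ m≤j j≤m → here (cong b (≤-antisym j≤m m≤j))
  branch-walk {m} (≤′-step {n} m≤n) with branch-walk m≤n
  ... | ys , w , visited , covers = ys ∷ʳ b (suc n) , w ++ʷ (branch-step n ∷ []) , visited′ , covers′
    where
    visited′ : ∀ {u} → u ∈ b m ∷ (ys ∷ʳ b (suc n)) → ∃ λ j → m ≤ j × b j ≡ u
    visited′ u∈ with ∈-++⁻ (b m ∷ ys) u∈
    ... | inj₁ u∈ys        = visited u∈ys
    ... | inj₂ (here refl) = suc n , ≤-trans (≤′⇒≤ m≤n) (n≤1+n n) , refl
    covers′ : ∀ {j} → m ≤ j → j ≤ suc n → b j ∈ b m ∷ (ys ∷ʳ b (suc n))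
    covers′ m≤j j≤sn with m≤n⇒m<n∨m≡n j≤sn
    ... | inj₁ j<sn = ∈-++⁺ˡ (covers m≤j (≤-pred j<sn))
    ... | inj₂ refl = ∈-++⁺ʳ (b m ∷ ys) (here refl)

  module RecurrentBuds (em : ExcludedMiddle 0ℓ) where

    m₀ : ℕ
    m₀ = proj₁ (eventually-recurrent b em T branch∈T)

    late-recurrent : ∀ n → m₀ ≤ n → Recurrent b (b n)
    late-recurrent = proj₂ (eventually-recurrent b em T branch∈T)

    recurrent? : ∀ v → Dec (Recurrent b v)
    recurrent? _ = em

    recurrent-bud? : ∀ s → Dec (InDom π s × Recurrent b s)
    recurrent-bud? s = inDom? s ×-dec recurrent? s

    η : List Node
    η = filter recurrent-bud? T

    η-bud : ∀ {s} → s ∈ η → InDom π s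
    η-bud s∈η = proj₁ (proj₂ (∈-filter⁻ recurrent-bud? {xs = T} s∈η))

    η-recurrent : ∀ {s} → s ∈ η → Recurrent b s
    η-recurrent s∈η = proj₂ (proj₂ (∈-filter⁻ recurrent-bud? {xs = T} s∈η))

    C[η]⇒recurrent : ∀ {u} → InC π η u → Recurrent b u
    C[η]⇒recurrent (s , s∈η , cyc) = recurrent-cycle (η-recurrent s∈η) cyc

    recurrent⇒C[η] : ∀ {u} → Recurrent b u → InC π η u
    recurrent⇒C[η] rec with rec m₀
    ... | n , m₀≤n , bn≡u with recurrent⇒on-cycle rec bn≡u
    ...   | j , n≤j , cyc =
      b j ,
      ∈-filter⁺ recurrent-bud? (branch∈T j) (cycle⇒bud cyc , late-recurrent j (≤-trans m₀≤n n≤j)) ,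
      cyc

    η-sc : StronglyConnected π η
    η-sc with recurrent-window b (filter recurrent? T)
                (All.tabulate (λ v∈ → proj₂ (∈-filter⁻ recurrent? {xs = T} v∈))) m₀
    ... | N , m₀≤N , visits with late-recurrent m₀ ≤-refl (suc N)
    ... | n , sN≤n , bn≡bm₀ with branch-walk (≤⇒≤′ (≤-trans m₀≤N (≤-trans (n≤1+n N) sN≤n)))
    ... | ys , w , visited , covers = circuit⇒sc (All.tabulate η-bud) circuit
      where
      to′ : ∀ {u} → u ∈ b m₀ ∷ ys → InC π η u
      to′ u∈ = let j , m₀≤j , bj≡u = visited u∈ in
               recurrent⇒C[η] (subst (Recurrent b) bj≡u (late-recurrent j m₀≤j))
      from′ : ∀ {u} → InC π η u → u ∈ b m₀ ∷ ys
      from′ i = let j , m₀≤j , j≤N , bj≡u =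
                      All.lookup visits (∈-filter⁺ recurrent? (InC⊆T i) (C[η]⇒recurrent i))
                in subst (_∈ b m₀ ∷ ys) bj≡u (covers m₀≤j (≤-trans j≤N (≤-trans (n≤1+n N) sN≤n)))
      circuit : Circuit η (b m₀)
      circuit = record
        { route = ys ; closed = subst (λ a → Walk (b m₀) a ys) bn≡bm₀ w ; nodes = λ _ → mk⇔ to′ from′ }

    branch-condition : InductionOrder π →
                       ∃ λ x → (∃ λ m → ∀ n → m ≤ n → x ∈FVˢ λˢ π (b n))
                             × (∀ m → ∃ λ n → m ≤ n × β (b n) ≡ nothing × IsCase x (ρ (b n)))
    branch-condition io with InductionOrder.sc-max io η η-sc
    ... | s , s∈η , max = xv s , (m₀ , eventually-free) , cases
      where
      open InductionOrder io
      eventually-free : ∀ n → m₀ ≤ n → xv s ∈FVˢ λˢ π (b n)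
      eventually-free n m₀≤n = let t , t∈η , cyc = recurrent⇒C[η] (late-recurrent n m₀≤n) in
                               order-free (η-bud t∈η) (η-bud s∈η) (max t∈η) cyc
      cases : ∀ m → ∃ λ n → m ≤ n × β (b n) ≡ nothing × IsCase (xv s) (ρ (b n))
      cases m with case-along (η-bud s∈η)
      ... | u , cyc@(_ , _ , _ , u⊑s) , u≢s , is-case with C[η]⇒recurrent (s , s∈η , cyc) m
      ...   | n , m≤n , bn≡u =
        n , m≤n ,
        subst (λ w → β w ≡ nothing) (sym bn≡u) (⊏⇒not-bud (⊑∧≢⇒⊏ u⊑s u≢s) (bud∈T (η-bud s∈η))) ,
        subst (λ w → IsCase (xv s) (ρ w)) (sym bn≡u) is-case

lemma5p5 : (∀ {ℓ} → ExcludedMiddle ℓ) →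
           (π : PreProof) → IsProof π ⇔ InductionOrder π
lemma5p5 em π = mk⇔ (ProofToOrder.proof⇒induction-order π em)
                    (λ io b infinite → OrderToProof.RecurrentBuds.branch-condition π b infinite em io)
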